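{- Let $T$ be a tournament of order $n\geq 3$. Then the line graph $L(T)$ is disconnected if and only if $T$ has an arc $(u, v)$ with $d^-_{T}(u)=0$ and $d^+_{T}(v)=0$.
   Context: A tournament is an orientation of a complete graph. $d^-_T(u)$ and $d^+_T(v)$ denote in-degree and out-degree. The line graph $L(T)$ is the graph whose vertex set is the arc set of $T$, in which two arcs are adjacent if and only if they form a directed path of length $2$ (arcs $(u,v),(v,w)$ with $u,v,w$ distinct). -}

module Defs where

open import Data.Nat using (ℕ)
open import Data.Fin using (Fin)
open import Data.Fin.Subset using (Subset; ∣_∣)
open import Data.Vec using (tabulate)
open import Data.Bool using (Bool)
open import Data.Product using (Σ; _×_; _,_; proj₁; proj₂)
open import Data.Sum using (_⊎_)
open import Relation.Nullary using (¬_; Dec)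
open import Relation.Nullary.Decidable using (⌊_⌋)
open import Relation.Binary.PropositionalEquality using (_≡_; _≢_)
open import Relation.Binary.Construct.Closure.ReflexiveTransitive using (Star)

record Tournament (n : ℕ) : Set₁ where
  field
    _⇒_      : Fin n → Fin n → Set
    arc?     : (u v : Fin n) → Dec (u ⇒ v)
    irrefl   : (u : Fin n) → ¬ (u ⇒ u)
    antisym  : (u v : Fin n) → u ⇒ v → ¬ (v ⇒ u)
    total    : (u v : Fin n) → u ≢ v → (u ⇒ v) ⊎ (v ⇒ u)

module _ {n : ℕ} (T : Tournament n) where
  open Tournament T

  outNbhd : Fin n → Subset n
  outNbhd v = tabulate (λ x → ⌊ arc? v x ⌋)

  inNbhd : Fin n → Subset n
  inNbhd u = tabulate (λ x → ⌊ arc? x u ⌋)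

  outdeg : Fin n → ℕ
  outdeg v = ∣ outNbhd v ∣

  indeg : Fin n → ℕ
  indeg u = ∣ inNbhd u ∣

  -- arcs of T: the vertices of the line graph
  Arc : Set
  Arc = Σ (Fin n) λ u → Σ (Fin n) λ v → u ⇒ v

  tail head : Arc → Fin n
  tail a = proj₁ a
  head a = proj₁ (proj₂ a)

  -- a and b form a directed path of length 2 (a = (u,v), b = (v,w), u,v,w distinct)
  Path2 : Arc → Arc → Set
  Path2 a b = (head a ≡ tail b) × (tail a ≢ head b)

  LAdj : Arc → Arc → Set
  LAdj a b = Path2 a b ⊎ Path2 b a

  LConnected : Set
  LConnected = (a b : Arc) → Star LAdj a b

  LDisconnected : Set
  LDisconnected = ¬ LConnected

-- If no arc goes from a source to a sink, every arc has an endpoint m with both an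
-- in-neighbour z and an out-neighbour w, and every arc at such an m is joined in L(T)
-- to the arc (m, w) (through (z, m) for arcs leaving m). Two such "internal" vertices
-- are joined by an arc of the tournament, so L(T) is connected. Conversely an arc from
-- a source to a sink is isolated in L(T), while n ≥ 3 provides a second arc.
module Submission where

open import Defs
open import Data.Nat using (ℕ; _≥_; zero; s≤s)
import Data.Nat as ℕ
open import Data.Fin using (Fin; _≟_) renaming (zero to fzero; suc to fsuc)
open import Data.Fin.Subset using (Subset; ∣_∣; _∈_; Empty; ⁅_⁆)
open import Data.Fin.Subset.Properties
  using (Empty-unique; ∣⊥∣≡0; ∣⁅x⁆∣≡1; x∈⁅y⁆⇒x≡y; p⊆q⇒∣p∣≤∣q∣)
open import Data.Fin.Properties using (any?)
open import Data.Vec using (tabulate)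
open import Data.Vec.Properties using (lookup∘tabulate; []=⇒lookup; lookup⇒[]=)
open import Data.Bool.Properties using (T-≡)
open import Data.Product using (Σ; ∃; _×_; _,_)
open import Data.Sum using (inj₁; inj₂)
open import Function.Bundles using (_⇔_; mk⇔; Equivalence)
open import Relation.Nullary using (¬_; Dec; yes; no; contradiction)
open import Relation.Nullary.Decidable using (⌊_⌋; _×-dec_; toWitness; fromWitness)
open import Relation.Unary using (Pred; Decidable)
open import Level using (0ℓ)
open import Relation.Binary using (Rel; Symmetric)
open import Relation.Binary.PropositionalEquality
  using (_≡_; _≢_; refl; sym; trans; cong; subst; subst₂)
open import Relation.Binary.Construct.Closure.ReflexiveTransitive
  using (Star; ε; _◅_; _◅◅_; reverse)

∣p∣≡0⇒Empty : ∀ {n} {p : Subset n} → ∣ p ∣ ≡ 0 → Empty p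
∣p∣≡0⇒Empty {p = p} ∣p∣≡0 (x , x∈p) =
  contradiction (subst₂ ℕ._≤_ (∣⁅x⁆∣≡1 x) ∣p∣≡0 ∣⁅x⁆∣≤∣p∣) λ ()
  where
  ∣⁅x⁆∣≤∣p∣ : ∣ ⁅ x ⁆ ∣ ℕ.≤ ∣ p ∣
  ∣⁅x⁆∣≤∣p∣ = p⊆q⇒∣p∣≤∣q∣ (λ y∈⁅x⁆ → subst (_∈ p) (sym (x∈⁅y⁆⇒x≡y x y∈⁅x⁆)) x∈p)

Empty⇒∣p∣≡0 : ∀ {n} {p : Subset n} → Empty p → ∣ p ∣ ≡ 0
Empty⇒∣p∣≡0 {n} empty = trans (cong ∣_∣ (Empty-unique empty)) (∣⊥∣≡0 n)

module _ {n p} {P : Pred (Fin n) p} (P? : Decidable P) where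

  ∈-tabulate-⌊⌋⇔ : ∀ {x} → x ∈ tabulate (λ y → ⌊ P? y ⌋) ⇔ P x
  ∈-tabulate-⌊⌋⇔ {x} = mk⇔
    (λ x∈ → toWitness (Equivalence.from T-≡
      (trans (sym (lookup∘tabulate _ x)) ([]=⇒lookup x∈))))
    (λ px → lookup⇒[]= x _
      (trans (lookup∘tabulate _ x) (Equivalence.to T-≡ (fromWitness px))))

  ∣tabulate-⌊⌋∣≡0⇔ : ∣ tabulate (λ y → ⌊ P? y ⌋) ∣ ≡ 0 ⇔ (∀ x → ¬ P x)
  ∣tabulate-⌊⌋∣≡0⇔ = mk⇔
    (λ ∣p∣≡0 x px → ∣p∣≡0⇒Empty ∣p∣≡0 (x , Equivalence.from ∈-tabulate-⌊⌋⇔ px))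
    (λ ¬P → Empty⇒∣p∣≡0 (λ (x , x∈) → ¬P x (Equivalence.to ∈-tabulate-⌊⌋⇔ x∈)))

Star-from-isolated : ∀ {a ℓ} {A : Set a} {R : Rel A ℓ} {x y} →
                     (∀ z → ¬ R x z) → Star R x y → x ≡ y
Star-from-isolated isolated ε        = refl
Star-from-isolated isolated (r ◅ _) = contradiction r (isolated _)

∃-distinct-from-two : ∀ {n} → n ≥ 3 → (u v : Fin n) → ∃ λ w → w ≢ u × w ≢ v
∃-distinct-from-two (s≤s (s≤s (s≤s _))) = third
  where
  third : ∀ {k} (u v : Fin (3 ℕ.+ k)) → ∃ λ w → w ≢ u × w ≢ v
  third fzero           fzero           = fsuc fzero , (λ ()) , (λ ())
  third fzero           (fsuc fzero)    = fsuc (fsuc fzero) , (λ ()) , (λ ())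
  third fzero           (fsuc (fsuc _)) = fsuc fzero , (λ ()) , (λ ())
  third (fsuc fzero)    fzero           = fsuc (fsuc fzero) , (λ ()) , (λ ())
  third (fsuc (fsuc _)) fzero           = fsuc fzero , (λ ()) , (λ ())
  third (fsuc _)        (fsuc _)        = fzero , (λ ()) , (λ ())

module _ {n} (T : Tournament n) where
  open Tournament T

  Source Sink : Fin n → Set
  Source u = ∀ x → ¬ (x ⇒ u)
  Sink   v = ∀ x → ¬ (v ⇒ x)

  indeg≡0⇔Source : ∀ {u} → indeg T u ≡ 0 ⇔ Source u
  indeg≡0⇔Source {u} = ∣tabulate-⌊⌋∣≡0⇔ (λ x → arc? x u)

  outdeg≡0⇔Sink : ∀ {v} → outdeg T v ≡ 0 ⇔ Sink v
  outdeg≡0⇔Sink {v} = ∣tabulate-⌊⌋∣≡0⇔ (arc? v)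

  SourceSinkArc : Set
  SourceSinkArc = Σ (Fin n) λ u → Σ (Fin n) λ v → u ⇒ v × (indeg T u ≡ zero) × (outdeg T v ≡ zero)

  sourceSinkArc? : Dec SourceSinkArc
  sourceSinkArc? = any? λ u → any? λ v →
    arc? u v ×-dec (indeg T u ℕ.≟ zero ×-dec outdeg T v ℕ.≟ zero)

  Internal : Fin n → Set
  Internal m = (∃ λ z → z ⇒ m) × (∃ λ w → m ⇒ w)

  data Incident : Arc T → Fin n → Set where
    tail-incident : ∀ {x y} (p : x ⇒ y) → Incident (x , y , p) x
    head-incident : ∀ {x y} (p : x ⇒ y) → Incident (x , y , p) y

  _~_ : Rel (Arc T) 0ℓ
  _~_ = Star (LAdj T)

  LAdj-sym : Symmetric (LAdj T)
  LAdj-sym (inj₁ path) = inj₂ path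
  LAdj-sym (inj₂ path) = inj₁ path

  ~-sym : Symmetric _~_
  ~-sym = reverse (λ {a} {b} → LAdj-sym {a} {b})

  ⇒-path2 : ∀ {x y z} (p : x ⇒ y) (q : y ⇒ z) → Path2 T (x , y , p) (y , z , q)
  ⇒-path2 {x} {y} p q = refl , λ { refl → antisym x y p q }

  incident-~-out-arc : ∀ {z m w a} (p : z ⇒ m) (q : m ⇒ w) → Incident a m → a ~ (m , w , q)
  incident-~-out-arc p q (head-incident r) = inj₁ (⇒-path2 r q) ◅ ε
  incident-~-out-arc p q (tail-incident r) =
    _◅_ {j = _ , _ , p} (inj₂ (⇒-path2 p r)) (inj₁ (⇒-path2 p q) ◅ ε)

  internal-incident-~ : ∀ {m a b} → Internal m → Incident a m → Incident b m → a ~ b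
  internal-incident-~ ((_ , p) , (_ , q)) ia ib =
    incident-~-out-arc p q ia ◅◅ ~-sym (incident-~-out-arc p q ib)

  joining-arc : ∀ {m m'} → m ≢ m' → Σ (Arc T) λ c → Incident c m × Incident c m'
  joining-arc {m} {m'} m≢m' with total m m' m≢m'
  ... | inj₁ q = _ , tail-incident q , head-incident q
  ... | inj₂ q = _ , head-incident q , tail-incident q

  internals-incident-~ : ∀ {m m' a b} → Internal m → Internal m' →
                         Incident a m → Incident b m' → a ~ b
  internals-incident-~ {m} {m'} I I' ia ib with m ≟ m'
  ... | yes refl = internal-incident-~ I ia ib
  ... | no m≢m'  with joining-arc m≢m'
  ...   | c , ic , ic' = internal-incident-~ I ia ic ◅◅ internal-incident-~ I' ic' ib

  internal-endpoint : ¬ SourceSinkArc → (a : Arc T) → ∃ λ m → Internal m × Incident a m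
  internal-endpoint noArc (x , y , p) with any? (λ z → arc? z x) | any? (arc? y)
  ... | yes into-x | _         = x , (into-x , (y , p)) , tail-incident p
  ... | no _       | yes out-y = y , ((x , p) , out-y) , head-incident p
  ... | no ¬into-x | no ¬out-y = contradiction
    (x , y , p , Equivalence.from indeg≡0⇔Source (λ z q → ¬into-x (z , q))
               , Equivalence.from outdeg≡0⇔Sink (λ w q → ¬out-y (w , q)))
    noArc

  connected-without-sourceSinkArc : ¬ SourceSinkArc → LConnected T
  connected-without-sourceSinkArc noArc a b
    with internal-endpoint noArc a | internal-endpoint noArc b
  ... | _ , I , ia | _ , I' , ib = internals-incident-~ I I' ia ib

  source-sink-arc-isolated : ∀ {u v} (p : u ⇒ v) → Source u → Sink v → ∀ b → ¬ LAdj T (u , v , p) b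
  source-sink-arc-isolated p source sink (_ , y , q) (inj₁ (refl , _)) = sink y q
  source-sink-arc-isolated p source sink (x , _ , q) (inj₂ (refl , _)) = source x q

  disconnected-with-source-sink-arc : n ≥ 3 → ∀ {u v} (p : u ⇒ v) → Source u → Sink v →
                                      LDisconnected T
  disconnected-with-source-sink-arc n≥3 {u} {v} p source sink connected
    with ∃-distinct-from-two n≥3 u v
  ... | w , w≢u , w≢v with total u w (λ u≡w → w≢u (sym u≡w))
  ...   | inj₂ w⇒u = source w w⇒u
  ...   | inj₁ u⇒w = w≢v (sym (cong (head T) (Star-from-isolated
            (source-sink-arc-isolated p source sink) (connected (u , v , p) (u , w , u⇒w)))))

corollary2p2 : (n : ℕ) → n ≥ 3 → (T : Tournament n) →
    LDisconnected T ⇔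
      Σ (Fin n) (λ u → Σ (Fin n) (λ v →
        Tournament._⇒_ T u v × (indeg T u ≡ zero) × (outdeg T v ≡ zero)))
corollary2p2 n n≥3 T = mk⇔ sourceSinkArc-from-disconnected disconnected-from-sourceSinkArc
  where
  disconnected-from-sourceSinkArc : SourceSinkArc T → LDisconnected T
  disconnected-from-sourceSinkArc (u , v , p , indeg≡0 , outdeg≡0) =
    disconnected-with-source-sink-arc T n≥3 p
      (Equivalence.to (indeg≡0⇔Source T) indeg≡0) (Equivalence.to (outdeg≡0⇔Sink T) outdeg≡0)

  sourceSinkArc-from-disconnected : LDisconnected T → SourceSinkArc T
  sourceSinkArc-from-disconnected disconnected with sourceSinkArc? T
  ... | yes arc  = arc
  ... | no noArc = contradiction (connected-without-sourceSinkArc T noArc) disconnected
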